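{- For every finite multiset $\Gamma$ of IMLL formulas and every IMLL formula $\phi$: if $\Gamma\vdash\phi$ then $\Gamma\Vdash\phi$.
   Context: Fix a countably infinite set $\mathbb{A}$ of atoms. IMLL formulas: $\phi::=p\in\mathbb A\mid\phi\otimes\phi\mid\mathrm I\mid\phi\multimap\phi$. $\Gamma,\Delta$ denote finite multisets of formulas, $P,S,T,U,V$ finite multisets of atoms, "$\Gamma,\Delta$" multiset union, $\varnothing$ the empty multiset. $\Gamma\vdash\phi$ means the sequent $\Gamma\triangleright\phi$ is derivable in the system with rules: $\phi\triangleright\phi$; from $\Gamma,\phi\triangleright\psi$ infer $\Gamma\triangleright\phi\multimap\psi$; from $\Gamma\triangleright\phi\multimap\psi$ and $\Delta\triangleright\phi$ infer $\Gamma,\Delta\triangleright\psi$; $\varnothing\triangleright\mathrm I$; from $\Gamma\triangleright\phi$ and $\Delta\triangleright\mathrm I$ infer $\Gamma,\Delta\triangleright\phi$; from $\Gamma\triangleright\phi$ and $\Delta\triangleright\psi$ infer $\Gamma,\Delta\triangleright\phi\otimes\psi$; from $\Gamma\triangleright\phi\otimes\psi$ and $\Delta,\phi,\psi\triangleright\chi$ infer $\Gamma,\Delta\triangleright\chi$. An atomic rule is $(P_1\triangleright p_1,\dots,P_n\triangleright p_n)\Rightarrow p$ ($n\ge0$, $P_i$ finite multisets of atoms, $p_i,p$ atoms). A base is a (possibly infinite) set of atomic rules; $\mathscr C\supseteq\mathscr B$ means extension. Derivability $P\vdash_{\mathscr B}q$ is the least relation with: $[p]\vdash_{\mathscr B}p$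 for every atom $p$; if $(P_1\triangleright p_1,\dots,P_n\triangleright p_n)\Rightarrow p\in\mathscr B$ and $S_i,P_i\vdash_{\mathscr B}p_i$ for $i=1,\dots,n$, then $S_1,\dots,S_n\vdash_{\mathscr B}p$. Support is defined inductively: $\Vdash^P_{\mathscr B}p$ iff $P\vdash_{\mathscr B}p$; $\Vdash^P_{\mathscr B}\phi\otimes\psi$ iff for every $\mathscr X\supseteq\mathscr B$, every $U$ and every atom $p$, if $\phi,\psi\Vdash^U_{\mathscr X}p$ then $\Vdash^{P,U}_{\mathscr X}p$; $\Vdash^P_{\mathscr B}\mathrm I$ iff for every $\mathscr X\supseteq\mathscr B$, $U$, atom $p$, if $\Vdash^U_{\mathscr X}p$ then $\Vdash^{P,U}_{\mathscr X}p$; $\Vdash^P_{\mathscr B}\phi\multimap\psi$ iff $\phi\Vdash^P_{\mathscr B}\psi$; for nonempty $\Gamma,\Delta$: $\Vdash^P_{\mathscr B}\Gamma,\Delta$ iff there are $U,V$ with $P=U,V$, $\Vdash^U_{\mathscr B}\Gamma$ and $\Vdash^V_{\mathscr B}\Delta$ (for a singleton $[\phi]$ this is $\Vdash^P_{\mathscr B}\phi$); for nonempty $\Gamma$: $\Gamma\Vdash^P_{\mathscr B}\phi$ iff for every $\mathscr X\supseteq\mathscr B$ and every $U$, if $\Vdash^U_{\mathscr X}\Gamma$ then $\Vdash^{P,U}_{\mathscr X}\phi$; for empty $\Gamma$, $\Gamma\Vdash^P_{\mathscr B}\phi$ means $\Vdash^P_{\mathscr B}\phi$. Validity: $\Gamma\Vdash\phi$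 iff $\Gamma\Vdash^{\varnothing}_{\mathscr B}\phi$ for every base $\mathscr B$. -}

module Defs where

open import Level using (Lift; 0ℓ) renaming (suc to lsuc)
open import Data.Nat using (ℕ)
open import Data.List using (List; []; _∷_; _++_; [_])
open import Data.Product using (Σ; _×_; _,_; ∃-syntax)
open import Data.List.Relation.Binary.Permutation.Propositional using (_↭_)

Atom : Set
Atom = ℕ

-- Finite multisets are represented by lists; all notions below are
-- invariant under permutation (_↭_), i.e. they only depend on the multiset.

infixr 6 _⊗_
infixr 5 _⊸_

data Formula : Set where
  atom : Atom → Formula
  _⊗_  : Formula → Formula → Formula
  I    : Formula
  _⊸_  : Formula → Formula → Formula

infix 3 _⊢_

data _⊢_ : List Formula → Formula → Set where
  exch : ∀ {Γ Δ φ} → Γ ↭ Δ → Γ ⊢ φ → Δ ⊢ φ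
  ax   : ∀ {φ} → [ φ ] ⊢ φ
  ⊸I   : ∀ {Γ φ ψ} → Γ ++ [ φ ] ⊢ ψ → Γ ⊢ φ ⊸ ψ
  ⊸E   : ∀ {Γ Δ φ ψ} → Γ ⊢ φ ⊸ ψ → Δ ⊢ φ → Γ ++ Δ ⊢ ψ
  II   : [] ⊢ I
  IE   : ∀ {Γ Δ φ} → Γ ⊢ φ → Δ ⊢ I → Γ ++ Δ ⊢ φ
  ⊗I   : ∀ {Γ Δ φ ψ} → Γ ⊢ φ → Δ ⊢ ψ → Γ ++ Δ ⊢ φ ⊗ ψ
  ⊗E   : ∀ {Γ Δ φ ψ χ} → Γ ⊢ φ ⊗ ψ → Δ ++ φ ∷ ψ ∷ [] ⊢ χ → Γ ++ Δ ⊢ χ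

-- (P₁ ▷ p₁, …, Pₙ ▷ pₙ) ⇒ p
record Rule : Set where
  constructor _⇒_
  field
    premises   : List (List Atom × Atom)
    conclusion : Atom

Base : Set₁
Base = Rule → Set

_⊇_ : Base → Base → Set
C ⊇ B = ∀ r → B r → C r

mutual
  data Deriv (B : Base) : List Atom → Atom → Set where
    ref : ∀ {p} → Deriv B [ p ] p
    app : ∀ {prems p S} → B (prems ⇒ p) → DerivAll B prems S → Deriv B S p

  -- DerivAll B [(P₁,p₁),…,(Pₙ,pₙ)] S : S = S₁,…,Sₙ with Sᵢ,Pᵢ ⊢_ℬ pᵢ
  data DerivAll (B : Base) : List (List Atom × Atom) → List Atom → Set where
    nil  : DerivAll B [] []
    cons : ∀ {P q prems S T U} →
           Deriv B (S ++ P) q → DerivAll B prems T → U ↭ S ++ T →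
           DerivAll B ((P , q) ∷ prems) U

Support : Base → List Atom → Formula → Set₁
Support B P (atom p) = Lift (lsuc 0ℓ) (Deriv B P p)
Support B P (φ ⊗ ψ) =
  ∀ (X : Base) → X ⊇ B → ∀ (U : List Atom) (p : Atom) →
  -- φ , ψ ⊩^U_X p  (unfolded)
  (∀ (Y : Base) → Y ⊇ X → ∀ (W : List Atom) →
     (∃[ W₁ ] ∃[ W₂ ] (W ↭ W₁ ++ W₂ × Support Y W₁ φ × Support Y W₂ ψ)) →
     Support Y (U ++ W) (atom p)) →
  Support X (P ++ U) (atom p)
Support B P I =
  ∀ (X : Base) → X ⊇ B → ∀ (U : List Atom) (p : Atom) →
  Support X U (atom p) → Support X (P ++ U) (atom p)
Support B P (φ ⊸ ψ) =
  -- φ ⊩^P_ℬ ψ (unfolded)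
  ∀ (X : Base) → X ⊇ B → ∀ (U : List Atom) →
  Support X U φ → Support X (P ++ U) ψ

-- Support of a nonempty multiset  ⊩^P_ℬ Γ  (Γ given as head ∷ tail)
SupportCtx : Base → List Atom → Formula → List Formula → Set₁
SupportCtx B P φ [] = Support B P φ
SupportCtx B P φ (ψ ∷ Γ) =
  ∃[ U ] ∃[ V ] (P ↭ U ++ V × Support B U φ × SupportCtx B V ψ Γ)

SupportSeq : Base → List Atom → List Formula → Formula → Set₁
SupportSeq B P [] φ = Support B P φ
SupportSeq B P (γ ∷ Γ) φ =
  ∀ (X : Base) → X ⊇ B → ∀ (U : List Atom) →
  SupportCtx X U γ Γ → Support X (P ++ U) φ

infix 3 _⊩_
_⊩_ : List Formula → Formula → Set₁
Γ ⊩ φ = ∀ (B : Base) → SupportSeq B [] Γ φ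

-- The only delicate rules are ⊗E and IE: the ⊗ and I
-- clauses only quantify over atomic conclusions, so one first shows, by
-- induction on χ, that such a clause can be eliminated into any formula χ.

module Submission where

open import Defs
open import Data.List using (List)

open import Level using (Lift; lift; 0ℓ) renaming (suc to lsuc)
open import Data.List using ([]; _∷_; _++_; [_])
open import Data.Product using (_,_; ∃-syntax; _×_)
open import Relation.Binary.PropositionalEquality using (_≡_; refl)
open import Data.List.Relation.Binary.Permutation.Propositional
open import Data.List.Relation.Binary.Permutation.Propositional.Properties
open import Algebra.Bundles using (CommutativeMonoid)
open import Algebra.Properties.CommutativeSemigroup
  (CommutativeMonoid.commutativeSemigroup (++-commutativeMonoid {A = Atom}))
  using (xy∙z≈xz∙y)

⊇-refl : ∀ {B} → B ⊇ B
⊇-refl r x = x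

⊇-trans : ∀ {B C D} → C ⊇ B → D ⊇ C → D ⊇ B
⊇-trans e e′ r x = e′ r (e r x)

Deriv-resp-↭ : ∀ {B P Q p} → P ↭ Q → Deriv B P p → Deriv B Q p
Deriv-resp-↭ P↭Q ref with ↭-singleton-inv (↭-sym P↭Q)
... | refl = ref
Deriv-resp-↭ P↭Q (app r nil) with ↭-empty-inv (↭-sym P↭Q)
... | refl = app r nil
Deriv-resp-↭ P↭Q (app r (cons d ds U↭)) =
  app r (cons d ds (↭-trans (↭-sym P↭Q) U↭))

mutual
  Deriv-mono : ∀ {B C P p} → C ⊇ B → Deriv B P p → Deriv C P p
  Deriv-mono e ref        = ref
  Deriv-mono e (app r ds) = app (e _ r) (DerivAll-mono e ds)

  DerivAll-mono : ∀ {B C ps P} → C ⊇ B → DerivAll B ps P → DerivAll C ps P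
  DerivAll-mono e nil            = nil
  DerivAll-mono e (cons d ds U↭) = cons (Deriv-mono e d) (DerivAll-mono e ds) U↭

Support-resp-↭ : ∀ φ {B P Q} → P ↭ Q → Support B P φ → Support B Q φ
Support-resp-↭ (atom p) P↭Q (lift d)  = lift (Deriv-resp-↭ P↭Q d)
Support-resp-↭ (φ ⊗ ψ)  P↭Q s X e U p h = Support-resp-↭ (atom p) (++⁺ʳ U P↭Q) (s X e U p h)
Support-resp-↭ I        P↭Q s X e U p h = Support-resp-↭ (atom p) (++⁺ʳ U P↭Q) (s X e U p h)
Support-resp-↭ (φ ⊸ ψ)  P↭Q s X e U u   = Support-resp-↭ ψ (++⁺ʳ U P↭Q) (s X e U u)

Support-mono : ∀ φ {B C P} → C ⊇ B → Support B P φ → Support C P φ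
Support-mono (atom p) e (lift d) = lift (Deriv-mono e d)
Support-mono (φ ⊗ ψ)  e s X e′  = s X (⊇-trans e e′)
Support-mono I        e s X e′  = s X (⊇-trans e e′)
Support-mono (φ ⊸ ψ)  e s X e′  = s X (⊇-trans e e′)

-- Unlike SupportCtx this also covers the empty context, supported by ∅ only.
Supports : Base → List Atom → List Formula → Set₁
Supports B P []      = Lift (lsuc 0ℓ) (P ↭ [])
Supports B P (γ ∷ Γ) = ∃[ U ] ∃[ V ] (P ↭ U ++ V × Support B U γ × Supports B V Γ)

SupportCtx⇒Supports : ∀ γ Γ {B P} → SupportCtx B P γ Γ → Supports B P (γ ∷ Γ)
SupportCtx⇒Supports γ []      {P = P} s = P , [] , ↭-sym (++-identityʳ P) , s , lift ↭-refl
SupportCtx⇒Supports γ (ψ ∷ Γ) (U , V , P↭ , s , ss) =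
  U , V , P↭ , s , SupportCtx⇒Supports ψ Γ ss

Supports-resp-↭ : ∀ Γ {B P Q} → P ↭ Q → Supports B P Γ → Supports B Q Γ
Supports-resp-↭ []      P↭Q (lift P↭)             = lift (↭-trans (↭-sym P↭Q) P↭)
Supports-resp-↭ (γ ∷ Γ) P↭Q (U , V , P↭ , s , ss) = U , V , ↭-trans (↭-sym P↭Q) P↭ , s , ss

Supports-mono : ∀ Γ {B C P} → C ⊇ B → Supports B P Γ → Supports C P Γ
Supports-mono []      e ss                    = ss
Supports-mono (γ ∷ Γ) e (U , V , P↭ , s , ss) = U , V , P↭ , Support-mono γ e s , Supports-mono Γ e ss

Supports-exch : ∀ {Γ Δ B P} → Γ ↭ Δ → Supports B P Γ → Supports B P Δ
Supports-exch refl         ss                    = ss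
Supports-exch (prep γ Γ↭Δ) (U , V , P↭ , s , ss) = U , V , P↭ , s , Supports-exch Γ↭Δ ss
Supports-exch (swap γ δ Γ↭Δ) (U , V , P↭ , s , (U′ , V′ , V↭ , s′ , ss)) =
  U′ , U ++ V′ , ↭-trans P↭ (↭-trans (++⁺ˡ U V↭) (shifts U U′)) ,
  s′ , (U , V′ , ↭-refl , s , Supports-exch Γ↭Δ ss)
Supports-exch (trans Γ↭Θ Θ↭Δ) ss = Supports-exch Θ↭Δ (Supports-exch Γ↭Θ ss)

Supports-++ : ∀ Γ Δ {B P Q} → Supports B P Γ → Supports B Q Δ → Supports B (P ++ Q) (Γ ++ Δ)
Supports-++ []      Δ {Q = Q} (lift P↭) ts = Supports-resp-↭ Δ (↭-sym (++⁺ʳ Q P↭)) ts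
Supports-++ (γ ∷ Γ) Δ {Q = Q} (U , V , P↭ , s , ss) ts =
  U , V ++ Q , ↭-trans (++⁺ʳ Q P↭) (++-assoc U V Q) , s , Supports-++ Γ Δ ss ts

Supports-++⁻ : ∀ Γ Δ {B P} → Supports B P (Γ ++ Δ) →
  ∃[ P₁ ] ∃[ P₂ ] (P ↭ P₁ ++ P₂ × Supports B P₁ Γ × Supports B P₂ Δ)
Supports-++⁻ []      Δ {P = P} ss = [] , P , ↭-refl , lift ↭-refl , ss
Supports-++⁻ (γ ∷ Γ) Δ (U , V , P↭ , s , ss) with Supports-++⁻ Γ Δ ss
... | V₁ , V₂ , V↭ , ss₁ , ss₂ =
  U ++ V₁ , V₂ , ↭-trans P↭ (↭-trans (++⁺ˡ U V↭) (↭-sym (++-assoc U V₁ V₂))) ,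
  (U , V₁ , ↭-refl , s , ss₁) , ss₂

-- The shape of the ⊗ and I clauses: P supports every atom that is supported
-- together with any multiset satisfying K.  For K = "supports φ, ψ" this is
-- Support B P (φ ⊗ ψ) on the nose.
Elimination : (Base → List Atom → Set₁) → Base → List Atom → Set₁
Elimination K B P =
  ∀ X → X ⊇ B → ∀ U p →
  (∀ Y → Y ⊇ X → ∀ W → K Y W → Support Y (U ++ W) (atom p)) →
  Support X (P ++ U) (atom p)

Elimination-mono : ∀ {K B C P} → C ⊇ B → Elimination K B P → Elimination K C P
Elimination-mono e c X e′ = c X (⊇-trans e e′)

eliminate : ∀ χ {K B P Q} → Elimination K B P →
  (∀ X → X ⊇ B → ∀ W → K X W → Support X (Q ++ W) χ) →
  Support B (P ++ Q) χ
eliminate (atom p) {B = B} {Q = Q} c h = c B ⊇-refl Q p h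
eliminate (χ₁ ⊗ χ₂) {P = P} {Q} c h X e U p k =
  Support-resp-↭ (atom p) (↭-sym (++-assoc P Q U))
    (eliminate (atom p) (Elimination-mono e c) λ Y e′ W w →
      Support-resp-↭ (atom p) (xy∙z≈xz∙y Q W U)
        (h Y (⊇-trans e e′) W w Y ⊇-refl U p λ Z e″ → k Z (⊇-trans e′ e″)))
eliminate I {P = P} {Q} c h X e U p k =
  Support-resp-↭ (atom p) (↭-sym (++-assoc P Q U))
    (eliminate (atom p) (Elimination-mono e c) λ Y e′ W w →
      Support-resp-↭ (atom p) (xy∙z≈xz∙y Q W U)
        (h Y (⊇-trans e e′) W w Y ⊇-refl U p (Support-mono (atom p) e′ k)))
eliminate (χ₁ ⊸ χ₂) {P = P} {Q} c h X e U u =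
  Support-resp-↭ χ₂ (↭-sym (++-assoc P Q U))
    (eliminate χ₂ (Elimination-mono e c) λ Y e′ W w →
      Support-resp-↭ χ₂ (xy∙z≈xz∙y Q W U)
        (h Y (⊇-trans e e′) W w Y ⊇-refl U (Support-mono χ₁ e′ u)))

Support-I⇒Elimination : ∀ {B P} → Support B P I →
  Elimination (λ _ W → Lift (lsuc 0ℓ) (W ≡ [])) B P
Support-I⇒Elimination i X e U p h =
  i X e U p (Support-resp-↭ (atom p) (++-identityʳ U) (h X ⊇-refl [] (lift refl)))

Support-I-elim : ∀ φ {B P Q} → Support B Q I → Support B P φ → Support B (P ++ Q) φ
Support-I-elim φ {P = P} {Q} i s =
  Support-resp-↭ φ (++-comm Q P)
    (eliminate φ (Support-I⇒Elimination i) λ { X e [] (lift refl) →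
      Support-resp-↭ φ (↭-sym (++-identityʳ P)) (Support-mono φ e s) })

Support-⊗-intro : ∀ {φ ψ B P₁ P₂} → Support B P₁ φ → Support B P₂ ψ →
  Support B (P₁ ++ P₂) (φ ⊗ ψ)
Support-⊗-intro {φ} {ψ} {P₁ = P₁} {P₂} s t X e U p h =
  Support-resp-↭ (atom p) (++-comm U (P₁ ++ P₂))
    (h X ⊇-refl (P₁ ++ P₂) (P₁ , P₂ , ↭-refl , Support-mono φ e s , Support-mono ψ e t))

infix 3 _⊨_
_⊨_ : List Formula → Formula → Set₁
Γ ⊨ φ = ∀ B P → Supports B P Γ → Support B P φ

⊨-split : ∀ Γ Δ χ →
  (∀ {B P₁ P₂} → Supports B P₁ Γ → Supports B P₂ Δ → Support B (P₁ ++ P₂) χ) →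
  Γ ++ Δ ⊨ χ
⊨-split Γ Δ χ f B P ss with Supports-++⁻ Γ Δ ss
... | P₁ , P₂ , P↭ , ss₁ , ss₂ = Support-resp-↭ χ (↭-sym P↭) (f ss₁ ss₂)

soundness : ∀ {Γ φ} → Γ ⊢ φ → Γ ⊨ φ
soundness (exch Γ↭Δ d) B P ss = soundness d B P (Supports-exch (↭-sym Γ↭Δ) ss)
soundness {φ = φ} ax B P (U , V , P↭ , s , lift V↭) =
  Support-resp-↭ φ (↭-sym (↭-trans P↭ (↭-trans (++⁺ˡ U V↭) (++-identityʳ U)))) s
soundness (⊸I {Γ} {φ} d) B P ss X e U u =
  soundness d X (P ++ U) (Supports-++ Γ [ φ ] (Supports-mono Γ e ss) (SupportCtx⇒Supports φ [] u))
soundness (⊸E {Γ} {Δ} {ψ = ψ} d₁ d₂) = ⊨-split Γ Δ ψ λ {B} {P₁} {P₂} ss₁ ss₂ →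
  soundness d₁ B P₁ ss₁ B ⊇-refl P₂ (soundness d₂ B P₂ ss₂)
soundness II B P (lift P↭) X e U p k = Support-resp-↭ (atom p) (↭-sym (++⁺ʳ U P↭)) k
soundness (IE {Γ} {Δ} {φ} d₁ d₂) = ⊨-split Γ Δ φ λ {B} {P₁} {P₂} ss₁ ss₂ →
  Support-I-elim φ (soundness d₂ B P₂ ss₂) (soundness d₁ B P₁ ss₁)
soundness (⊗I {Γ} {Δ} {φ} {ψ} d₁ d₂) = ⊨-split Γ Δ (φ ⊗ ψ) λ {B} {P₁} {P₂} ss₁ ss₂ →
  Support-⊗-intro (soundness d₁ B P₁ ss₁) (soundness d₂ B P₂ ss₂)
soundness (⊗E {Γ} {Δ} {φ} {ψ} {χ} d₁ d₂) = ⊨-split Γ Δ χ λ {B} {P₁} {P₂} ss₁ ss₂ →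
  eliminate χ (soundness d₁ B P₁ ss₁) λ X e W w →
    soundness d₂ X (P₂ ++ W)
      (Supports-++ Δ (φ ∷ ψ ∷ []) (Supports-mono Δ e ss₂) (SupportCtx⇒Supports φ [ ψ ] w))

theorem3 : (Γ : List Formula) (φ : Formula) → Γ ⊢ φ → Γ ⊩ φ
theorem3 []      φ d B         = soundness d B [] (lift ↭-refl)
theorem3 (γ ∷ Γ) φ d B X e U s = soundness d X U (SupportCtx⇒Supports γ Γ s)
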